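{- Let $G$ be a finite abelian group with identity $1$, let $S$ be an inverse-closed subset of $G\setminus\{1\}$ with $|S|\ge 3$, let $s\in S$ be such that $H=\langle S\setminus\{s,s^{ -1}\}\rangle \neq G$, and let $\Gamma=\mathrm{Cay}(G;S)$. Suppose $[G:H]=2$ and the order of $s$ is at least $4$. If $\Gamma$ is distance-regular, then: (i) $a_1\in\{0,2\}$, and $a_1=2$ if and only if $s^2\in S$; (ii) if $G$ is not generated by $s$, then $c_2\in\{2,4\}$.
   Context: The Cayley graph $\mathrm{Cay}(G;S)$ has vertex set $G$, with $g$ adjacent to $h$ iff $h=gs'$ for some $s'\in S$. A connected graph $\Gamma$ with distance $\partial$ is distance-regular if for each $i$ up to the diameter the numbers $c_i(x,y)=|N_{i-1}(x)\cap N(y)|$, $a_i(x,y)=|N_i(x)\cap N(y)|$, $b_i(x,y)=|N_{i+1}(x)\cap N(y)|$ depend only on $i=\partial(x,y)$; their common values are the intersection numbers $c_i,a_i,b_i$. Here $N_j(x)$ is the set of vertices at distance $j$ from $x$ and $N(y)=N_1(y)$. -}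

module Defs where

open import Data.Nat using (ℕ; zero; suc; _<_; _≤_; _*_)
open import Data.Fin using (Fin)
open import Data.Fin.Subset using (Subset; _∈_; ∣_∣)
open import Data.Product using (Σ; _×_; ∃)
open import Relation.Nullary using (¬_)
open import Relation.Binary.PropositionalEquality using (_≡_; _≢_)
open import Function.Bundles using (_⇔_)
open import Algebra.Core using (Op₁; Op₂)

-- A finite abelian group of order n is represented as an abelian group
-- structure (with propositional equality) on the carrier Fin n; every
-- finite abelian group is isomorphic to one of these.
module FinGroup {n : ℕ} (_∙_ : Op₂ (Fin n)) (ε : Fin n) (_⁻¹ : Op₁ (Fin n)) where

  G : Set
  G = Fin n

  HasCard : (G → Set) → ℕ → Set
  HasCard P m = Σ (Subset n) λ A → (∀ z → (z ∈ A) ⇔ P z) × ∣ A ∣ ≡ m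

  pow : G → ℕ → G
  pow g zero = ε
  pow g (suc k) = g ∙ pow g k

  OrderAtLeast : G → ℕ → Set
  OrderAtLeast g m = ∀ k → 1 ≤ k → k < m → pow g k ≢ ε

  data Gen (T : G → Set) : G → Set where
    gen-ε   : Gen T ε
    gen-el  : ∀ {x} → T x → Gen T x
    gen-mul : ∀ {x y} → Gen T x → Gen T y → Gen T (x ∙ y)
    gen-inv : ∀ {x} → Gen T x → Gen T (x ⁻¹)

  GenProper : (G → Set) → Set
  GenProper T = ∃ λ g → ¬ Gen T g

  GenIndex : (G → Set) → ℕ → Set
  GenIndex T k = Σ ℕ λ h → HasCard (Gen T) h × n ≡ k * h

  RemovePair : Subset n → G → G → Set
  RemovePair S s x = x ∈ S × x ≢ s × x ≢ s ⁻¹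

  Single : G → G → Set
  Single s x = x ≡ s

  module Cayley (S : Subset n) where

    Adj : G → G → Set
    Adj g h = ∃ λ s' → s' ∈ S × h ≡ g ∙ s'

    data Walk : ℕ → G → G → Set where
      walk-nil  : ∀ {x} → Walk 0 x x
      walk-cons : ∀ {k x y z} → Adj x y → Walk k y z → Walk (suc k) x z

    Dist : G → G → ℕ → Set
    Dist x y d = Walk d x y × (∀ k → k < d → ¬ Walk k x y)

    Connected : Set
    Connected = ∀ x y → ∃ λ d → Dist x y d

    -- Γ is distance-regular with intersection numbers c, a, b:
    -- connected, and for all x, y with ∂(x,y) = i,
    --   |N_{i-1}(x) ∩ N(y)| = c i, |N_i(x) ∩ N(y)| = a i, |N_{i+1}(x) ∩ N(y)| = b i.
    -- (For i = 0 the set N_{-1}(x) is empty; the predicate `suc j ≡ i` encodes j = i-1.)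
    IsDistanceRegular : (c a b : ℕ → ℕ) → Set
    IsDistanceRegular c a b =
      Connected ×
      (∀ x y i → Dist x y i →
         HasCard (λ z → Adj y z × Σ ℕ λ j → suc j ≡ i × Dist x z j) (c i) ×
         HasCard (λ z → Adj y z × Dist x z i) (a i) ×
         HasCard (λ z → Adj y z × Dist x z (suc i)) (b i))

module Submission where

-- Since Γ is connected, S generates G, so s ∉ H; since [G:H] = 2, s² ∈ H.
-- (i)  a₁ counts the common neighbours of 1 and s.  A neighbour s·s' of s
--      lying in S is s² (if s' = s) or s⁻¹ (if s' ∈ H, forcing s'⁻¹ = s²);
--      hence the set is {s², s⁻¹} if s² ∈ S and empty otherwise.
-- (ii) If ⟨s⟩ ≠ G some t ∈ S ∖ {s,s⁻¹} differs from s⁻², and y = s·t is at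
--      distance 2 from 1.  Its neighbours in S are s and t, together with
--      s⁻¹ and s²t exactly when s²t ∈ S; hence c₂ ∈ {2,4}.

open import Defs
open import Data.Nat using (ℕ; zero; suc; _+_; _≤_; _<_; _≥_; z≤n; s≤s)
open import Data.Nat.Properties using (+-mono-≤; +-cancelˡ-≤; ≤-trans; module ≤-Reasoning; +-0-commutativeMonoid)
open import Data.Bool using (true; false; if_then_else_)
open import Data.Fin using (Fin; zero; suc; _≟_)
open import Data.Fin.Properties using (any?)
open import Data.Fin.Subset using (Subset; _∈_; _∉_; ∣_∣; ⁅_⁆)
open import Data.Fin.Subset.Properties using (_∈?_; ∣⁅x⁆∣≡1; x∈⁅y⁆⇔x≡y; p⊆q⇒∣p∣≤∣q∣)
open import Data.Fin.Permutation using (permutation)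
open import Data.Vec using ([]; _∷_; lookup)
open import Data.Vec.Properties using ([]=⇒lookup; lookup⇒[]=)
open import Data.List using (List; []; _∷_; length)
open import Data.List.Membership.Propositional using () renaming (_∈_ to _∈ₗ_; _∉_ to _∉ₗ_)
open import Data.List.Relation.Unary.Any using (here; there)
open import Data.List.Relation.Unary.All using ([]; _∷_)
open import Data.List.Relation.Unary.All.Properties using (All¬⇒¬Any)
open import Data.List.Relation.Unary.AllPairs using ([]; _∷_)
open import Data.List.Relation.Unary.Unique.Propositional using (Unique)
open import Data.Empty using (⊥; ⊥-elim)
open import Data.Product using (Σ; _×_; _,_; proj₁; proj₂)
open import Data.Sum using (_⊎_; inj₁; inj₂)
open import Relation.Nullary using (¬_; Dec; yes; no; contradiction)
open import Relation.Nullary.Decidable using (_×-dec_; ¬?)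
open import Relation.Binary.PropositionalEquality
open import Function.Bundles using (_⇔_; mk⇔; Equivalence)
open import Algebra.Core using (Op₁; Op₂)
open import Algebra.Bundles using (Group; AbelianGroup)
open import Algebra.Structures using (IsGroup; IsAbelianGroup)
open import Algebra.Properties.CommutativeMonoid.Sum +-0-commutativeMonoid
  using (sum; ∑-distrib-+; sum-cong-≗; sum-permute)

open Equivalence using (to; from)

-- Counting in Fin n.

𝟙 : ∀ {n} → Subset n → Fin n → ℕ
𝟙 A z = if lookup A z then 1 else 0

𝟙-∈ : ∀ {n} {A : Subset n} {z} → z ∈ A → 𝟙 A z ≡ 1
𝟙-∈ z∈A = cong (λ b → if b then 1 else 0) ([]=⇒lookup z∈A)

𝟙-∉ : ∀ {n} {A : Subset n} {z} → z ∉ A → 𝟙 A z ≡ 0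
𝟙-∉ {A = A} {z} z∉A with lookup A z in eq
... | true  = contradiction (lookup⇒[]= z A eq) z∉A
... | false = refl

∣∣≡∑𝟙 : ∀ {n} (A : Subset n) → ∣ A ∣ ≡ sum (𝟙 A)
∣∣≡∑𝟙 []          = refl
∣∣≡∑𝟙 (true ∷ A)  = cong suc (∣∣≡∑𝟙 A)
∣∣≡∑𝟙 (false ∷ A) = ∣∣≡∑𝟙 A

∈⇒∣∣≥1 : ∀ {n} {A : Subset n} {z} → z ∈ A → 1 ≤ ∣ A ∣
∈⇒∣∣≥1 {A = A} {z} z∈A = subst (_≤ ∣ A ∣) (∣⁅x⁆∣≡1 z)
  (p⊆q⇒∣p∣≤∣q∣ (λ x∈⁅z⁆ → subst (_∈ A) (sym (to x∈⁅y⁆⇔x≡y x∈⁅z⁆)) z∈A))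

sum-≤1 : ∀ {n} (f : Fin n → ℕ) → (∀ z → f z ≤ 1) → sum f ≤ n
sum-≤1 {zero}  f f≤1 = z≤n
sum-≤1 {suc n} f f≤1 = +-mono-≤ (f≤1 zero) (sum-≤1 (λ z → f (suc z)) (λ z → f≤1 (suc z)))

𝟙-exclusive : ∀ {n} (A : Subset n) (x y w : Fin n)
  → (x ∈ A → y ∈ A → ⊥) → (x ∈ A → w ∈ A → ⊥) → (y ∈ A → w ∈ A → ⊥)
  → 𝟙 A x + (𝟙 A y + 𝟙 A w) ≤ 1
𝟙-exclusive A x y w xy xw yw
  with lookup A x in ex | lookup A y in ey | lookup A w in ew
... | true  | true  | _     = ⊥-elim (xy (lookup⇒[]= x A ex) (lookup⇒[]= y A ey))
... | true  | false | true  = ⊥-elim (xw (lookup⇒[]= x A ex) (lookup⇒[]= w A ew))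
... | false | true  | true  = ⊥-elim (yw (lookup⇒[]= y A ey) (lookup⇒[]= w A ew))
... | true  | false | false = s≤s z≤n
... | false | true  | false = s≤s z≤n
... | false | false | true  = s≤s z≤n
... | false | false | false = z≤n

occ : ∀ {n} → Fin n → List (Fin n) → ℕ
occ z []      = 0
occ z (a ∷ L) = 𝟙 ⁅ a ⁆ z + occ z L

occ-∉ : ∀ {n} {z : Fin n} L → z ∉ₗ L → occ z L ≡ 0
occ-∉ []      z∉L = refl
occ-∉ (a ∷ L) z∉L =
  cong₂ _+_ (𝟙-∉ (λ z∈⁅a⁆ → z∉L (here (to x∈⁅y⁆⇔x≡y z∈⁅a⁆))))
            (occ-∉ L (λ z∈L → z∉L (there z∈L)))

occ-∈ : ∀ {n} {z : Fin n} {L} → Unique L → z ∈ₗ L → occ z L ≡ 1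
occ-∈ {L = a ∷ L} (a∉L ∷ _) (here refl) =
  cong₂ _+_ (𝟙-∈ {A = ⁅ a ⁆} (from x∈⁅y⁆⇔x≡y refl)) (occ-∉ L (All¬⇒¬Any a∉L))
occ-∈ {z = z} {a ∷ L} (a∉L ∷ uniq) (there z∈L) =
  cong₂ _+_ (𝟙-∉ (λ z∈⁅a⁆ → All¬⇒¬Any a∉L (subst (_∈ₗ L) (to x∈⁅y⁆⇔x≡y z∈⁅a⁆) z∈L)))
            (occ-∈ uniq z∈L)

∑occ≡length : ∀ {n} (L : List (Fin n)) → sum (λ z → occ z L) ≡ length L
∑occ≡length {n} [] = sum-zero n
  where
  sum-zero : ∀ m → sum {m} (λ _ → 0) ≡ 0
  sum-zero zero    = refl
  sum-zero (suc m) = sum-zero m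
∑occ≡length (a ∷ L) = begin
  sum (λ z → 𝟙 ⁅ a ⁆ z + occ z L)     ≡⟨ ∑-distrib-+ (𝟙 ⁅ a ⁆) (λ z → occ z L) ⟩
  sum (𝟙 ⁅ a ⁆) + sum (λ z → occ z L) ≡⟨ cong₂ _+_ (trans (sym (∣∣≡∑𝟙 ⁅ a ⁆)) (∣⁅x⁆∣≡1 a)) (∑occ≡length L) ⟩
  suc (length L)                      ∎
  where open ≡-Reasoning

card-by-list : ∀ {n} (A : Subset n) {L} → Unique L → (∀ z → z ∈ A ⇔ z ∈ₗ L) → ∣ A ∣ ≡ length L
card-by-list A {L} uniq A⇔L = begin
  ∣ A ∣                  ≡⟨ ∣∣≡∑𝟙 A ⟩
  sum (𝟙 A)              ≡⟨ sum-cong-≗ 𝟙≗occ ⟩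
  sum (λ z → occ z L)    ≡⟨ ∑occ≡length L ⟩
  length L               ∎
  where
  open ≡-Reasoning
  𝟙≗occ : ∀ z → 𝟙 A z ≡ occ z L
  𝟙≗occ z with z ∈? A
  ... | yes z∈A = trans (𝟙-∈ z∈A) (sym (occ-∈ uniq (to (A⇔L z) z∈A)))
  ... | no  z∉A = trans (𝟙-∉ z∉A) (sym (occ-∉ L (λ z∈L → z∉A (from (A⇔L z) z∈L))))

-- Subgroups of a finite group.
module Subgroups {n} {_∙_ : Op₂ (Fin n)} {ε : Fin n} {_⁻¹ : Op₁ (Fin n)}
                 (isGroup : IsGroup _≡_ _∙_ ε _⁻¹) where

  open FinGroup _∙_ ε _⁻¹
  open IsGroup isGroup using (assoc)

  group : Group _ _
  group = record { isGroup = isGroup }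

  open import Algebra.Properties.Group group using (\\-leftDividesˡ; \\-leftDividesʳ; //-rightDividesʳ)

  sum-translate : (g : G) (f : G → ℕ) → sum (λ z → f (g ∙ z)) ≡ sum f
  sum-translate g f =
    sym (sum-permute f (permutation (g ∙_) ((g ⁻¹) ∙_) (\\-leftDividesˡ g) (\\-leftDividesʳ g)))

  gen-cancelʳ : ∀ {T x y} → Gen T y → Gen T (x ∙ y) → Gen T x
  gen-cancelʳ {T} {x} {y} y∈H xy∈H = subst (Gen T) (//-rightDividesʳ y x) (gen-mul xy∈H (gen-inv y∈H))

  -- A subgroup of index 2 contains the square of every element: otherwise
  -- H, g⁻¹H and g⁻²H would be three disjoint cosets in a group of order 2|H|.
  index-two-squares : ∀ {T} → GenIndex T 2 → ∀ g → Gen T (g ∙ g)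
  index-two-squares {T} (h , (A , A⇔H , ∣A∣≡h) , n≡2h) g with g ∈? A | (g ∙ g) ∈? A
  ... | yes g∈A | _        = gen-mul (to (A⇔H g) g∈A) (to (A⇔H g) g∈A)
  ... | no _    | yes gg∈A = to (A⇔H _) gg∈A
  ... | no g∉A  | no gg∉A  = contradiction (≤-trans h≥1 h≤0) λ ()
    where
    open ≤-Reasoning
    χ : G → ℕ
    χ = 𝟙 A
    inH : ∀ {z} → z ∈ A → Gen T z
    inH {z} = to (A⇔H z)
    cosets-disjoint : ∀ z → χ z + (χ (g ∙ z) + χ (g ∙ (g ∙ z))) ≤ 1
    cosets-disjoint z = 𝟙-exclusive A z (g ∙ z) (g ∙ (g ∙ z))
      (λ z∈A gz∈A → g∉A (from (A⇔H g) (gen-cancelʳ (inH z∈A) (inH gz∈A))))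
      (λ z∈A ggz∈A → gg∉A (from (A⇔H _) (gen-cancelʳ (inH z∈A) (subst (Gen T) (sym (assoc g g z)) (inH ggz∈A)))))
      (λ gz∈A ggz∈A → g∉A (from (A⇔H g) (gen-cancelʳ (inH gz∈A) (inH ggz∈A))))
    ∑χ≡h : sum χ ≡ h
    ∑χ≡h = trans (sym (∣∣≡∑𝟙 A)) ∣A∣≡h
    ∑χg≡h : sum (λ z → χ (g ∙ z)) ≡ h
    ∑χg≡h = trans (sum-translate g χ) ∑χ≡h
    ∑χgg≡h : sum (λ z → χ (g ∙ (g ∙ z))) ≡ h
    ∑χgg≡h = trans (sum-translate g (λ z → χ (g ∙ z))) ∑χg≡h
    three-h≤two-h : h + (h + h) ≤ h + (h + 0)
    three-h≤two-h = begin
      h + (h + h)                                       ≡⟨ cong₂ _+_ ∑χ≡h (cong₂ _+_ ∑χg≡h ∑χgg≡h) ⟨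
      sum χ + (sum (λ z → χ (g ∙ z)) + sum (λ z → χ (g ∙ (g ∙ z))))
                                                        ≡⟨ cong (sum χ +_) (∑-distrib-+ (λ z → χ (g ∙ z)) (λ z → χ (g ∙ (g ∙ z)))) ⟨
      sum χ + sum (λ z → χ (g ∙ z) + χ (g ∙ (g ∙ z)))   ≡⟨ ∑-distrib-+ χ (λ z → χ (g ∙ z) + χ (g ∙ (g ∙ z))) ⟨
      sum (λ z → χ z + (χ (g ∙ z) + χ (g ∙ (g ∙ z))))   ≤⟨ sum-≤1 _ cosets-disjoint ⟩
      n                                                 ≡⟨ n≡2h ⟩
      h + (h + 0)                                       ∎
    h≤0 : h ≤ 0
    h≤0 = +-cancelˡ-≤ h _ _ (+-cancelˡ-≤ h _ _ three-h≤two-h)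
    h≥1 : 1 ≤ h
    h≥1 = subst (1 ≤_) ∣A∣≡h (∈⇒∣∣≥1 (from (A⇔H ε) gen-ε))

-- Cayley graphs of a finite group.
module CayleyGraphs {n} {_∙_ : Op₂ (Fin n)} {ε : Fin n} {_⁻¹ : Op₁ (Fin n)}
                    (isGroup : IsGroup _≡_ _∙_ ε _⁻¹) (S : Subset n) where

  open FinGroup _∙_ ε _⁻¹
  open Cayley S
  open IsGroup isGroup using (identityˡ)

  walk-in-subgroup : ∀ {U k x y} → (∀ z → z ∈ S → Gen U z) → Walk k x y → Gen U x → Gen U y
  walk-in-subgroup S⊆U walk-nil x∈U = x∈U
  walk-in-subgroup S⊆U (walk-cons (s' , s'∈S , refl) w) x∈U =
    walk-in-subgroup S⊆U w (gen-mul x∈U (S⊆U s' s'∈S))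

  connected⇒generated : Connected → ∀ {U} → (∀ z → z ∈ S → Gen U z) → ∀ g → Gen U g
  connected⇒generated conn S⊆U g = walk-in-subgroup S⊆U (proj₁ (proj₂ (conn ε g))) gen-ε

  walk-zero : ∀ {x y} → Walk 0 x y → x ≡ y
  walk-zero walk-nil = refl

  walk-one : ∀ {z} → Walk 1 ε z → z ∈ S
  walk-one (walk-cons (s' , s'∈S , refl) walk-nil) = subst (_∈ S) (sym (identityˡ s')) s'∈S

  dist-one : ε ∉ S → ∀ z → Dist ε z 1 ⇔ z ∈ S
  dist-one ε∉S z = mk⇔ (λ (w , _) → walk-one w) λ z∈S →
    walk-cons (z , z∈S , sym (identityˡ z)) walk-nil , no-shorter z∈S
    where
    no-shorter : z ∈ S → ∀ k → k < 1 → ¬ Walk k ε z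
    no-shorter z∈S zero _ w = ε∉S (subst (_∈ S) (sym (walk-zero w)) z∈S)
    no-shorter z∈S (suc _) (s≤s ())

  dist-two : ∀ {a b} → a ∈ S → b ∈ S → a ∙ b ≢ ε → a ∙ b ∉ S → Dist ε (a ∙ b) 2
  dist-two {a} {b} a∈S b∈S ab≢ε ab∉S =
    walk-cons (a , a∈S , sym (identityˡ a)) (walk-cons (b , b∈S , refl) walk-nil) , no-shorter
    where
    no-shorter : ∀ k → k < 2 → ¬ Walk k ε (a ∙ b)
    no-shorter zero          _ w = ab≢ε (sym (walk-zero w))
    no-shorter (suc zero)    _ w = ab∉S (walk-one w)
    no-shorter (suc (suc _)) (s≤s (s≤s ()))

  hasCard-by-list : ∀ {P m L} → HasCard P m → Unique L → (∀ z → P z ⇔ z ∈ₗ L) → m ≡ length L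
  hasCard-by-list (A , A⇔P , ∣A∣≡m) uniq P⇔L =
    trans (sym ∣A∣≡m) (card-by-list A uniq λ z → mk⇔ (λ z∈A → to (P⇔L z) (to (A⇔P z) z∈A))
                                                       (λ z∈L → from (A⇔P z) (from (P⇔L z) z∈L)))

-- The hypotheses of Lemma 6.1.
module Lemma6p1Setting
  {n} {_∙_ : Op₂ (Fin n)} {ε : Fin n} {_⁻¹ : Op₁ (Fin n)}
  (isAbelianGroup : IsAbelianGroup _≡_ _∙_ ε _⁻¹)
  (S : Subset n) (S-inverse-closed : ∀ x → x ∈ S → (x ⁻¹) ∈ S) (ε∉S : ε ∉ S)
  (s : Fin n) (s∈S : s ∈ S)
  (H-proper : FinGroup.GenProper _∙_ ε _⁻¹ (FinGroup.RemovePair _∙_ ε _⁻¹ S s))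
  (H-index-two : FinGroup.GenIndex _∙_ ε _⁻¹ (FinGroup.RemovePair _∙_ ε _⁻¹ S s) 2)
  (order-s≥4 : FinGroup.OrderAtLeast _∙_ ε _⁻¹ s 4)
  (c a b : ℕ → ℕ) (distance-regular : FinGroup.Cayley.IsDistanceRegular _∙_ ε _⁻¹ S c a b)
  where

  open FinGroup _∙_ ε _⁻¹
  open Cayley S
  open IsAbelianGroup isAbelianGroup using (isGroup; assoc; comm; identityʳ; inverseʳ)
  open Subgroups isGroup
  open CayleyGraphs isGroup S

  abelianGroup : AbelianGroup _ _
  abelianGroup = record { isAbelianGroup = isAbelianGroup }

  open import Algebra.Properties.AbelianGroup abelianGroup
    using (inverseˡ-unique; identityˡ-unique; identityʳ-unique; ⁻¹-involutive; ⁻¹-anti-homo-∙; xyx⁻¹≈y; y≈x\\z; \\-leftDividesˡ; //-rightDividesʳ)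

  connected : Connected
  connected = proj₁ distance-regular

  T : G → Set
  T = RemovePair S s

  H : G → Set
  H = Gen T

  T? : ∀ z → Dec (T z)
  T? z = (z ∈? S) ×-dec (¬? (z ≟ s) ×-dec ¬? (z ≟ s ⁻¹))

  classify : ∀ {z} → z ∈ S → T z ⊎ (z ≡ s ⊎ z ≡ s ⁻¹)
  classify {z} z∈S with z ≟ s | z ≟ s ⁻¹
  ... | yes z≡s | _          = inj₂ (inj₁ z≡s)
  ... | no _    | yes z≡s⁻¹  = inj₂ (inj₂ z≡s⁻¹)
  ... | no z≢s  | no z≢s⁻¹   = inj₁ (z∈S , z≢s , z≢s⁻¹)

  -- s ∉ H: otherwise H ⊇ S, and S generates G.
  s∉H : ¬ H s
  s∉H s∈H = proj₂ H-proper (connected⇒generated connected S⊆H (proj₁ H-proper))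
    where
    S⊆H : ∀ z → z ∈ S → H z
    S⊆H z z∈S with classify z∈S
    ... | inj₁ z∈T          = gen-el z∈T
    ... | inj₂ (inj₁ refl)  = s∈H
    ... | inj₂ (inj₂ refl)  = gen-inv s∈H

  s⁻¹∉H : ¬ H (s ⁻¹)
  s⁻¹∉H s⁻¹∈H = s∉H (subst H (⁻¹-involutive s) (gen-inv s⁻¹∈H))

  s²∈H : H (s ∙ s)
  s²∈H = index-two-squares H-index-two s

  s²≢ε : s ∙ s ≢ ε
  s²≢ε s²≡ε = order-s≥4 2 (s≤s z≤n) (s≤s (s≤s (s≤s z≤n))) (trans (cong (s ∙_) (identityʳ s)) s²≡ε)

  s³≢ε : s ∙ (s ∙ s) ≢ ε
  s³≢ε s³≡ε = order-s≥4 3 (s≤s z≤n) (s≤s (s≤s (s≤s (s≤s z≤n)))) (trans (cong (λ w → s ∙ (s ∙ w)) (identityʳ s)) s³≡ε)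

  s≢s⁻¹ : s ≢ s ⁻¹
  s≢s⁻¹ s≡s⁻¹ = s²≢ε (trans (cong (s ∙_) s≡s⁻¹) (inverseʳ s))

  s²≢s⁻¹ : s ∙ s ≢ s ⁻¹
  s²≢s⁻¹ s²≡s⁻¹ = s³≢ε (trans (cong (s ∙_) s²≡s⁻¹) (inverseʳ s))

  inverse-of-factor : ∀ {x y w} → x ∙ y ≡ w ⁻¹ → y ⁻¹ ≡ w ∙ x
  inverse-of-factor {x} {y} {w} xy≡w⁻¹ = sym (inverseˡ-unique (w ∙ x) y (begin
    (w ∙ x) ∙ y   ≡⟨ assoc w x y ⟩
    w ∙ (x ∙ y)   ≡⟨ cong (w ∙_) xy≡w⁻¹ ⟩
    w ∙ (w ⁻¹)    ≡⟨ inverseʳ w ⟩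
    ε             ∎))
    where open ≡-Reasoning

  step-back : ∀ x w → x ∙ ((w ∙ x) ⁻¹) ≡ w ⁻¹
  step-back x w = trans (cong (x ∙_) (⁻¹-anti-homo-∙ w x)) (\\-leftDividesˡ x (w ⁻¹))

  near : ∀ {z} → z ∈ S → Dist ε z 1
  near {z} = from (dist-one ε∉S z)

  s-neighbour-in-S : ∀ {z} → Adj s z → z ∈ S → (s ∙ s) ∈ S × (z ≡ s ∙ s ⊎ z ≡ s ⁻¹)
  s-neighbour-in-S {z} (s' , s'∈S , z≡ss') z∈S with classify s'∈S
  ... | inj₂ (inj₁ refl) = subst (_∈ S) z≡ss' z∈S , inj₁ z≡ss'
  ... | inj₂ (inj₂ refl) = ⊥-elim (ε∉S (subst (_∈ S) (trans z≡ss' (inverseʳ s)) z∈S))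
  ... | inj₁ s'∈T with classify z∈S
  ...   | inj₁ z∈T        = ⊥-elim (s∉H (gen-cancelʳ (gen-el s'∈T) (subst H z≡ss' (gen-el z∈T))))
  ...   | inj₂ (inj₁ z≡s) = ⊥-elim (ε∉S (subst (_∈ S) (identityʳ-unique s s' (trans (sym z≡ss') z≡s)) s'∈S))
  ...   | inj₂ (inj₂ z≡s⁻¹) =
          subst (_∈ S) (inverse-of-factor (trans (sym z≡ss') z≡s⁻¹)) (S-inverse-closed s' s'∈S) , inj₂ z≡s⁻¹

  A₁ : G → Set
  A₁ z = Adj s z × Dist ε z 1

  A₁-card : HasCard A₁ (a 1)
  A₁-card = proj₁ (proj₂ (proj₂ distance-regular ε s 1 (near s∈S)))

  A₁-when-s²∈S : (s ∙ s) ∈ S → ∀ z → A₁ z ⇔ z ∈ₗ (s ∙ s) ∷ (s ⁻¹) ∷ []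
  A₁-when-s²∈S s²∈S z = mk⇔ listed common
    where
    listed : A₁ z → z ∈ₗ (s ∙ s) ∷ (s ⁻¹) ∷ []
    listed (s~z , 1~z) with proj₂ (s-neighbour-in-S s~z (walk-one (proj₁ 1~z)))
    ... | inj₁ z≡s² = here z≡s²
    ... | inj₂ z≡s⁻¹ = there (here z≡s⁻¹)
    common : z ∈ₗ (s ∙ s) ∷ (s ⁻¹) ∷ [] → A₁ z
    common (here refl) = (s , s∈S , refl) , near s²∈S
    common (there (here refl)) =
      ((s ∙ s) ⁻¹ , S-inverse-closed _ s²∈S , sym (step-back s s)) , near (S-inverse-closed s s∈S)

  A₁-when-s²∉S : (s ∙ s) ∉ S → ∀ z → A₁ z ⇔ z ∈ₗ []
  A₁-when-s²∉S s²∉S z = mk⇔ empty λ ()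
    where
    empty : A₁ z → z ∈ₗ []
    empty (s~z , 1~z) = contradiction (proj₁ (s-neighbour-in-S s~z (walk-one (proj₁ 1~z)))) s²∉S

  a₁≡2 : (s ∙ s) ∈ S → a 1 ≡ 2
  a₁≡2 s²∈S = hasCard-by-list A₁-card ((s²≢s⁻¹ ∷ []) ∷ [] ∷ []) (A₁-when-s²∈S s²∈S)

  a₁≡0 : (s ∙ s) ∉ S → a 1 ≡ 0
  a₁≡0 s²∉S = hasCard-by-list A₁-card [] (A₁-when-s²∉S s²∉S)

  part-i : (a 1 ≡ 0 ⊎ a 1 ≡ 2) × (a 1 ≡ 2 ⇔ (s ∙ s) ∈ S)
  part-i with (s ∙ s) ∈? S
  ... | yes s²∈S = inj₂ (a₁≡2 s²∈S) , mk⇔ (λ _ → s²∈S) a₁≡2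
  ... | no  s²∉S = inj₁ (a₁≡0 s²∉S)
                 , mk⇔ (λ a₁≡2 → contradiction (trans (sym (a₁≡0 s²∉S)) a₁≡2) λ ())
                       (λ s²∈S → contradiction s²∈S s²∉S)

  -- Part (ii).  If ⟨s⟩ ≠ G then some t ∈ T is not s⁻²: otherwise S ⊆ ⟨s⟩.
  t-outside-⟨s⟩ : GenProper (Single s) → Σ G λ t → T t × t ≢ (s ⁻¹) ∙ (s ⁻¹)
  t-outside-⟨s⟩ ⟨s⟩-proper with any? (λ t → T? t ×-dec ¬? (t ≟ (s ⁻¹) ∙ (s ⁻¹)))
  ... | yes found = found
  ... | no none   = ⊥-elim (proj₂ ⟨s⟩-proper (connected⇒generated connected S⊆⟨s⟩ (proj₁ ⟨s⟩-proper)))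
    where
    s⁻¹∈⟨s⟩ : Gen (Single s) (s ⁻¹)
    s⁻¹∈⟨s⟩ = gen-inv (gen-el refl)
    S⊆⟨s⟩ : ∀ z → z ∈ S → Gen (Single s) z
    S⊆⟨s⟩ z z∈S with classify z∈S
    ... | inj₂ (inj₁ z≡s)   = gen-el z≡s
    ... | inj₂ (inj₂ refl)  = s⁻¹∈⟨s⟩
    ... | inj₁ z∈T with z ≟ (s ⁻¹) ∙ (s ⁻¹)
    ...   | yes refl = gen-mul s⁻¹∈⟨s⟩ s⁻¹∈⟨s⟩
    ...   | no z≢s⁻² = ⊥-elim (none (z , z∈T , z≢s⁻²))

  -- For such t, the vertex y = s·t is at distance 2 from 1, and c₂ counts
  -- its neighbours in S.
  module AtDistanceTwo (t : G) (t∈T : T t) (t≢s⁻² : t ≢ (s ⁻¹) ∙ (s ⁻¹)) where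

    t∈S : t ∈ S
    t∈S = proj₁ t∈T

    y u : G
    y = s ∙ t
    u = s ∙ (s ∙ t)

    y∉H : ¬ H y
    y∉H y∈H = s∉H (gen-cancelʳ (gen-el t∈T) y∈H)

    u∈H : H u
    u∈H = subst H (assoc s s t) (gen-mul s²∈H (gen-el t∈T))

    y∉S : y ∉ S
    y∉S y∈S with classify y∈S
    ... | inj₁ y∈T          = y∉H (gen-el y∈T)
    ... | inj₂ (inj₁ y≡s)   = ε∉S (subst (_∈ S) (identityʳ-unique s t y≡s) t∈S)
    ... | inj₂ (inj₂ y≡s⁻¹) = t≢s⁻² (y≈x\\z s t (s ⁻¹) y≡s⁻¹)

    y-at-distance-two : Dist ε y 2
    y-at-distance-two = dist-two s∈S t∈S (λ y≡ε → y∉H (subst H (sym y≡ε) gen-ε)) y∉S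

    y-neighbour-in-S : ∀ {z} → Adj y z → z ∈ S → z ≡ s ⊎ (z ≡ t ⊎ (u ∈ S × (z ≡ s ⁻¹ ⊎ z ≡ u)))
    y-neighbour-in-S {z} (s' , s'∈S , z≡ys') z∈S with classify z∈S
    ... | inj₂ (inj₁ z≡s)   = inj₁ z≡s
    ... | inj₂ (inj₂ z≡s⁻¹) =
          inj₂ (inj₂ (subst (_∈ S) (inverse-of-factor (trans (sym z≡ys') z≡s⁻¹)) (S-inverse-closed s' s'∈S) , inj₁ z≡s⁻¹))
    ... | inj₁ z∈T with classify s'∈S
    ...   | inj₁ s'∈T       = ⊥-elim (y∉H (gen-cancelʳ (gen-el s'∈T) (subst H z≡ys' (gen-el z∈T))))
    ...   | inj₂ (inj₁ refl) = inj₂ (inj₂ (subst (_∈ S) z≡u z∈S , inj₂ z≡u))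
      where z≡u = trans z≡ys' (comm y s)
    ...   | inj₂ (inj₂ refl) = inj₂ (inj₁ (trans z≡ys' (xyx⁻¹≈y s t)))

    C₂ : G → Set
    C₂ z = Adj y z × Σ ℕ λ j → suc j ≡ 2 × Dist ε z j

    C₂-card : HasCard C₂ (c 2)
    C₂-card = proj₁ (proj₂ distance-regular ε y 2 y-at-distance-two)

    C₂⇒S : ∀ {z} → C₂ z → Adj y z × z ∈ S
    C₂⇒S (y~z , j , refl , dist) = y~z , walk-one (proj₁ dist)

    C₂-s : C₂ s
    C₂-s = (t ⁻¹ , S-inverse-closed t t∈S , sym (//-rightDividesʳ t s)) , 1 , refl , near s∈S

    C₂-t : C₂ t
    C₂-t = (s ⁻¹ , S-inverse-closed s s∈S , sym (xyx⁻¹≈y s t)) , 1 , refl , near t∈S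

    C₂-s⁻¹ : u ∈ S → C₂ (s ⁻¹)
    C₂-s⁻¹ u∈S = (u ⁻¹ , S-inverse-closed u u∈S , sym (step-back y s)) , 1 , refl , near (S-inverse-closed s s∈S)

    C₂-u : u ∈ S → C₂ u
    C₂-u u∈S = (s , s∈S , sym (comm y s)) , 1 , refl , near u∈S

    s≢t : s ≢ t
    s≢t s≡t = s∉H (subst H (sym s≡t) (gen-el t∈T))

    t≢u : t ≢ u
    t≢u t≡u = s²≢ε (identityˡ-unique (s ∙ s) t (sym (trans t≡u (sym (assoc s s t)))))

    C₂-when-u∈S : u ∈ S → ∀ z → C₂ z ⇔ z ∈ₗ s ∷ t ∷ (s ⁻¹) ∷ u ∷ []
    C₂-when-u∈S u∈S z = mk⇔ listed common
      where
      listed : C₂ z → z ∈ₗ s ∷ t ∷ (s ⁻¹) ∷ u ∷ []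
      listed z∈C₂ with C₂⇒S z∈C₂
      ... | y~z , z∈S with y-neighbour-in-S y~z z∈S
      ...   | inj₁ z≡s                    = here z≡s
      ...   | inj₂ (inj₁ z≡t)             = there (here z≡t)
      ...   | inj₂ (inj₂ (_ , inj₁ z≡s⁻¹)) = there (there (here z≡s⁻¹))
      ...   | inj₂ (inj₂ (_ , inj₂ z≡u))  = there (there (there (here z≡u)))
      common : z ∈ₗ s ∷ t ∷ (s ⁻¹) ∷ u ∷ [] → C₂ z
      common (here refl)                         = C₂-s
      common (there (here refl))                 = C₂-t
      common (there (there (here refl)))         = C₂-s⁻¹ u∈S
      common (there (there (there (here refl)))) = C₂-u u∈S

    C₂-when-u∉S : u ∉ S → ∀ z → C₂ z ⇔ z ∈ₗ s ∷ t ∷ []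
    C₂-when-u∉S u∉S z = mk⇔ listed common
      where
      listed : C₂ z → z ∈ₗ s ∷ t ∷ []
      listed z∈C₂ with C₂⇒S z∈C₂
      ... | y~z , z∈S with y-neighbour-in-S y~z z∈S
      ...   | inj₁ z≡s               = here z≡s
      ...   | inj₂ (inj₁ z≡t)        = there (here z≡t)
      ...   | inj₂ (inj₂ (u∈S , _))  = contradiction u∈S u∉S
      common : z ∈ₗ s ∷ t ∷ [] → C₂ z
      common (here refl)         = C₂-s
      common (there (here refl)) = C₂-t

    c₂-is-two-or-four : c 2 ≡ 2 ⊎ c 2 ≡ 4
    c₂-is-two-or-four with u ∈? S
    ... | yes u∈S = inj₂ (hasCard-by-list C₂-card distinct₄ (C₂-when-u∈S u∈S))
      where
      u∉H : ∀ {x} → ¬ H x → x ≢ u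
      u∉H x∉H x≡u = x∉H (subst H (sym x≡u) u∈H)
      distinct₄ : Unique (s ∷ t ∷ (s ⁻¹) ∷ u ∷ [])
      distinct₄ = (s≢t ∷ s≢s⁻¹ ∷ u∉H s∉H ∷ [])
                ∷ ((λ t≡s⁻¹ → s⁻¹∉H (subst H t≡s⁻¹ (gen-el t∈T))) ∷ t≢u ∷ [])
                ∷ (u∉H s⁻¹∉H ∷ [])
                ∷ [] ∷ []
    ... | no u∉S = inj₁ (hasCard-by-list C₂-card ((s≢t ∷ []) ∷ [] ∷ []) (C₂-when-u∉S u∉S))

  part-ii : GenProper (Single s) → c 2 ≡ 2 ⊎ c 2 ≡ 4
  part-ii ⟨s⟩-proper with t-outside-⟨s⟩ ⟨s⟩-proper
  ... | t , t∈T , t≢s⁻² = AtDistanceTwo.c₂-is-two-or-four t t∈T t≢s⁻²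

lemma6p1 : (n : ℕ) (_∙_ : Op₂ (Fin n)) (ε : Fin n) (_⁻¹ : Op₁ (Fin n))
    → IsAbelianGroup _≡_ _∙_ ε _⁻¹
    → (S : Subset n)
    → (∀ x → x ∈ S → (x ⁻¹) ∈ S)
    → ε ∉ S
    → ∣ S ∣ ≥ 3
    → (s : Fin n) → s ∈ S
    → FinGroup.GenProper _∙_ ε _⁻¹ (FinGroup.RemovePair _∙_ ε _⁻¹ S s)
    → FinGroup.GenIndex _∙_ ε _⁻¹ (FinGroup.RemovePair _∙_ ε _⁻¹ S s) 2
    → FinGroup.OrderAtLeast _∙_ ε _⁻¹ s 4
    → (c a b : ℕ → ℕ)
    → FinGroup.Cayley.IsDistanceRegular _∙_ ε _⁻¹ S c a b
    → ((a 1 ≡ 0 ⊎ a 1 ≡ 2) × (a 1 ≡ 2 ⇔ (s ∙ s) ∈ S))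
      × (FinGroup.GenProper _∙_ ε _⁻¹ (FinGroup.Single _∙_ ε _⁻¹ s)
         → c 2 ≡ 2 ⊎ c 2 ≡ 4)
lemma6p1 n _∙_ ε _⁻¹ isAbelianGroup S S-inverse-closed ε∉S _ s s∈S
         H-proper H-index-two order-s≥4 c a b distance-regular = part-i , part-ii
  where
  open Lemma6p1Setting isAbelianGroup S S-inverse-closed ε∉S s s∈S
                       H-proper H-index-two order-s≥4 c a b distance-regular
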